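{- Let $n \ge 1$. There is a polynomial $a_n(x) \in \mathbb{Q}[x]$ with $a_n(c) = \dim_k\left(R / I_{W}^{[\mathbf{n+c-1}]}\right)$ for every integer $c \ge 1$, and $$a_n(x) = \sum_{r=1}^{n} s(n,r)\, x(x+1)\cdots(x+r-1),$$ where $s(n,r)$ is the signless Stirling number of the first kind.
   Context: $k$ is a field, $R = k[x_1,\ldots,x_n]$, $\mathfrak{S}_n$ the permutations of $[n]$ in one-line notation. $\sigma$ avoids a pattern $\tau\in\mathfrak{S}_r$ if no subsequence of $\sigma(1)\cdots\sigma(n)$ has the same relative order as $\tau$. $W = \mathfrak{S}_n(132,312)$ is the set of permutations avoiding $132$ and $312$, and $I_W = \langle \prod_{i=1}^n x_i^{\sigma(i)} : \sigma \in W\rangle$. For $\mathbf{a}\in\mathbb{N}^n$ and a monomial ideal $I$ whose minimal generators divide $\mathbf{x}^{\mathbf{a}}$, the Alexander dual is $I^{[\mathbf{a}]} = \bigcap_{\mathbf{x}^{\mathbf{b}}} \mathfrak{m}^{\mathbf{a}\setminus\mathbf{b}}$ over minimal generators $\mathbf{x}^{\mathbf{b}}$ of $I$, with $(\mathbf{a}\setminus\mathbf{b})_i = a_i+1-b_i$ if $b_i\ge1$, $0$ if $b_i=0$, and $\mathfrak{m}^{\mathbf{d}} = \langle x_i^{d_i} : d_i\ge 1\rangle$. $\mathbf{n+c-1} = (n+c-1,\ldots,n+c-1)\in\mathbb{N}^n$. $s(n,r)$ is the number of permutations of $[n]$ with exactly $r$ cycles. -}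

module Defs where

open import Data.Nat as ℕ using (ℕ; zero; suc; _+_; _*_; _∸_; _≤_)
open import Data.Fin as Fin using (Fin; toℕ)
open import Data.Fin.Properties using (all?; _≟_)
open import Data.Vec using (Vec; []; _∷_; lookup; map; replicate)
open import Data.Nat.ListAction using (sum)
open import Data.List as L using (List; length; upTo; filter; concatMap; allFin)
open import Data.List.Membership.Propositional using (_∈_)
open import Data.List.Relation.Unary.Unique.Propositional using (Unique)
open import Data.Product using (Σ; ∃; ∃-syntax; _×_; _,_)
open import Relation.Binary.PropositionalEquality using (_≡_)
open import Relation.Nullary using (¬_; Dec)
open import Relation.Nullary.Decidable using (_×-dec_; _→-dec_)
open import Relation.Unary using (Decidable)

-- Permutations of [n] in one-line notation.
-- A word σ = σ(1)…σ(n) is stored as a vector over Fin n, with the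
-- value j : Fin n standing for j+1 ∈ [n].

Word : ℕ → Set
Word n = Vec (Fin n) n

IsPerm : ∀ {n} → Word n → Set
IsPerm {n} σ = ∀ (i j : Fin n) → lookup σ i ≡ lookup σ j → i ≡ j

isPerm? : ∀ {n} (σ : Word n) → Dec (IsPerm σ)
isPerm? σ = all? (λ i → all? (λ j → (lookup σ i ≟ lookup σ j) →-dec (i ≟ j)))

Contains : ∀ {n r} → Word n → Word r → Set
Contains {n} {r} σ τ =
  Σ (Fin r → Fin n) λ f →
    (∀ a b → a Fin.< b → f a Fin.< f b) ×
    (∀ a b → (lookup σ (f a) Fin.< lookup σ (f b) → lookup τ a Fin.< lookup τ b)
           × (lookup τ a Fin.< lookup τ b → lookup σ (f a) Fin.< lookup σ (f b)))

Avoids : ∀ {n r} → Word n → Word r → Set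
Avoids σ τ = ¬ Contains σ τ

-- the patterns 132 and 312 (0-based values)
p132 : Word 3
p132 = Fin.zero ∷ Fin.suc (Fin.suc Fin.zero) ∷ Fin.suc Fin.zero ∷ []

p312 : Word 3
p312 = Fin.suc (Fin.suc Fin.zero) ∷ Fin.zero ∷ Fin.suc Fin.zero ∷ []

InW : ∀ {n} → Word n → Set
InW σ = IsPerm σ × Avoids σ p132 × Avoids σ p312

-- Monomials x^e of R = k[x_1,…,x_n] are identified with exponent
-- vectors e ∈ ℕ^n.

Exp : ℕ → Set
Exp n = Vec ℕ n

_∣ₘ_ : ∀ {n} → Exp n → Exp n → Set
_∣ₘ_ {n} g b = ∀ (i : Fin n) → lookup g i ≤ lookup b i

-- exponent vector of the generator ∏ x_i^{σ(i)}
expOf : ∀ {n} → Word n → Exp n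
expOf σ = map (λ j → suc (toℕ j)) σ

GenIW : ∀ n → Exp n → Set
GenIW n b = Σ (Word n) λ σ → InW σ × b ≡ expOf σ

MinGen : ∀ {n} → (Exp n → Set) → Exp n → Set
MinGen G b = G b × (∀ g → G g → g ∣ₘ b → g ≡ b)

diffₐ : ∀ {n} → Exp n → Exp n → Exp n
diffₐ [] [] = []
diffₐ (a ∷ as) (zero ∷ bs) = 0 ∷ diffₐ as bs
diffₐ (a ∷ as) (suc b ∷ bs) = (suc a ∸ suc b) ∷ diffₐ as bs

-- x^e ∈ 𝔪^d = ⟨ x_i^{d_i} : d_i ≥ 1 ⟩
InMPow : ∀ {n} → Exp n → Exp n → Set
InMPow {n} d e = ∃[ i ] (1 ≤ lookup d i × lookup d i ≤ lookup e i)

-- x^e ∈ I^[a] = ⋂_{x^b minimal generator of I} 𝔪^{a∖b}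
InAlexDual : ∀ {n} → (Exp n → Set) → Exp n → Exp n → Set
InAlexDual G a e = ∀ b → MinGen G b → InMPow (diffₐ a b) e

HasCard : ∀ {n} → (Exp n → Set) → ℕ → Set
HasCard {n} P N =
  Σ (List (Exp n)) λ Ls →
    Unique Ls × (∀ e → (e ∈ Ls → P e) × (P e → e ∈ Ls)) × length Ls ≡ N

-- dim_k (R / J) = N for a monomial ideal J given by its monomial
-- membership: the standard monomials (those not in J) form a k-basis.
DimQuotientIs : ∀ {n} → (Exp n → Set) → ℕ → Set
DimQuotientIs J N = HasCard (λ e → ¬ J e) N

allWords : ∀ {n} m → List (Vec (Fin n) m)
allWords zero = L.[ [] ]
allWords {n} (suc m) = concatMap (λ i → L.map (i ∷_) (allWords m)) (allFin n)

iter : ∀ {n} → Word n → ℕ → Fin n → Fin n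
iter σ zero i = i
iter σ (suc k) i = lookup σ (iter σ k i)

-- i is the least element of its cycle (orbit) under σ; each cycle
-- has exactly one such element, so these count the cycles.
IsCycleMin : ∀ {n} → Word n → Fin n → Set
IsCycleMin {n} σ i = ∀ (k : Fin n) → i Fin.≤ iter σ (toℕ k) i

isCycleMin? : ∀ {n} (σ : Word n) → Decidable (IsCycleMin σ)
isCycleMin? σ i = all? (λ k → i Fin.≤? iter σ (toℕ k) i)

numCycles : ∀ {n} → Word n → ℕ
numCycles {n} σ = length (filter (isCycleMin? σ) (allFin n))

stirling1 : ℕ → ℕ → ℕ
stirling1 n r =
  length (filter (λ σ → isPerm? σ ×-dec (numCycles σ ℕ.≟ r)) (allWords {n} n))

rising : ℕ → ℕ → ℕ
rising x zero = 1
rising x (suc r) = rising x r * (x + r)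

aPoly : ℕ → ℕ → ℕ
aPoly n x = sum (L.map (λ r → stirling1 n r * rising x r) (L.map suc (upTo n)))

-- A monomial x^e is standard for the Alexander dual I_W^[a], a = (n+c-1, …), iff it avoids
-- 𝔪^(a∖b) for some generator b = (σ(1), …, σ(n)) of I_W, i.e. iff e_i + σ(i) ≤ n + c - 1 for all i:
-- the standard monomials form a union of boxes, one for each σ ∈ W. A permutation avoids 132 and
-- 312 iff its last entry is its minimum or its maximum and the remaining word does too. Splitting
-- on the last exponent then shows that the number A_n(c) of standard monomials satisfies
-- A_{n+1}(c) = c A_n(c+1) + n A_n(c), A_0 = 1. Inserting the new largest point into a cycle gives
-- s(n+1, r+1) = n s(n, r+1) + s(n, r), from which a_n (extended by its term r = 0, which vanishes
-- for n ≥ 1) satisfies the same recurrence and initial value.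

module Submission where

open import Defs
open import Data.Nat as ℕ using (ℕ; zero; suc; _+_; _*_; _∸_; _≤_; _<_; z≤n; s≤s)
import Data.Nat.Properties as ℕ
open import Data.Fin as F using (Fin; toℕ; inject₁; fromℕ; fromℕ<; #_)
import Data.Fin.Properties as F
open import Data.Fin.Relation.Unary.Top using (View; view; ‵fromℕ; ‵inject₁; view-fromℕ; view-inject₁)
open import Data.Fin.Permutation.Components using (transpose; transpose-inverse)
open import Data.Vec as V using (Vec; []; _∷_; lookup; tabulate; _∷ʳ_; replicate)
import Data.Vec.Properties as V
open import Data.Nat.ListAction using (sum)
open import Algebra.Properties.Monoid.Sum ℕ.+-0-monoid using (sum-syntax; sum⁺-syntax)
open import Algebra.Properties.Semiring.Sum ℕ.+-*-semiring
  using (∑-distrib-+; *-distribˡ-sum; sum-init-last; sum-cong-≗)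
open import Algebra.Properties.CommutativeSemigroup ℕ.*-commutativeSemigroup using (x∙yz≈y∙xz)
open import Data.List as L using (List; length; upTo; filter; allFin; _++_; cartesianProductWith)
import Data.List.Properties as L
open import Data.List.Membership.Propositional using (_∈_)
import Data.List.Membership.Propositional.Properties as ∈
open import Data.List.Membership.Propositional.Properties.WithK using (unique∧set⇒bag)
open import Data.List.Relation.Binary.BagAndSetEquality using (∼bag⇒↭)
open import Data.List.Relation.Binary.Permutation.Propositional using (_↭_)
import Data.List.Relation.Binary.Permutation.Propositional.Properties as ↭
open import Data.Nat.ListAction.Properties using (sum-↭)
open import Data.List.Relation.Unary.Unique.Propositional using (Unique)
import Data.List.Relation.Unary.Unique.Propositional.Properties as Unique
open import Data.Product as Product using (Σ; ∃; ∃₂; _×_; _,_; proj₁; proj₂)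
open import Data.Sum as Sum using (_⊎_; inj₁; inj₂)
open import Data.Empty using (⊥; ⊥-elim)
open import Data.Unit using (tt)
open import Function using (_∘_; id; Injective)
open import Function.Bundles using (mk⇔)
open import Relation.Binary.PropositionalEquality
  using (_≡_; _≢_; refl; sym; trans; cong; cong₂; subst; subst₂; module ≡-Reasoning)
open import Relation.Nullary using (¬_; yes; no; contradiction)
open import Relation.Nullary.Decidable using (map′; dec-true; dec-false; _×-dec_; toWitness)
open import Relation.Binary.Definitions using (tri<; tri≈; tri>)
open import Relation.Binary.Definitions using (DecidableEquality)
import Data.List.Relation.Unary.Any as Any
open import Data.Nat.DivMod using (_%_; _/_; m≡m%n+[m/n]*n; m%n<n)
open import Relation.Unary using (Decidable; Empty; U; _∪_; _≐_)
open import Relation.Unary.Properties using (≐-sym)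
import Data.List.Relation.Unary.All as All
import Data.List.Relation.Unary.AllPairs as AllPairs
open import Data.List.Relation.Unary.Any using (here)

-- Finite cardinalities

-- Defs.HasCard on an arbitrary carrier: HasCard {n} is definitionally HasCard′ on Exp n.
HasCard′ : {A : Set} → (A → Set) → ℕ → Set
HasCard′ {A} P N =
  Σ (List A) λ xs → Unique xs × (∀ x → (x ∈ xs → P x) × (P x → x ∈ xs)) × length xs ≡ N

module _ {A : Set} where

  card-unique : ∀ {P : A → Set} {N M} → HasCard′ P N → HasCard′ P M → N ≡ M
  card-unique (xs , !xs , xs↔ , refl) (ys , !ys , ys↔ , refl) =
    ↭.↭-length (∼bag⇒↭ (unique∧set⇒bag !xs !ys
      (mk⇔ (λ x∈ → proj₂ (ys↔ _) (proj₁ (xs↔ _) x∈)) (λ y∈ → proj₂ (xs↔ _) (proj₁ (ys↔ _) y∈)))))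

  card-cong : ∀ {P Q : A → Set} {N} → P ≐ Q → HasCard′ P N → HasCard′ Q N
  card-cong (P⊆Q , Q⊆P) (xs , !xs , xs↔ , len) =
    xs , !xs , (λ x → P⊆Q ∘ proj₁ (xs↔ x) , proj₂ (xs↔ x) ∘ Q⊆P) , len

  card-∅ : ∀ {P : A → Set} → Empty P → HasCard′ P 0
  card-∅ ∅ = L.[] , AllPairs.[] , (λ x → (λ ()) , λ p → contradiction p (∅ x)) , refl

  card-∪ : ∀ {P Q : A → Set} {N M} → HasCard′ P N → HasCard′ Q M →
           (∀ {x} → P x → ¬ Q x) → HasCard′ (P ∪ Q) (N + M)
  card-∪ (xs , !xs , xs↔ , refl) (ys , !ys , ys↔ , refl) disjoint =
    xs ++ ys ,
    Unique.++⁺ !xs !ys (λ (x∈xs , x∈ys) → disjoint (proj₁ (xs↔ _) x∈xs) (proj₁ (ys↔ _) x∈ys)) ,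
    (λ x → Sum.map (proj₁ (xs↔ x)) (proj₁ (ys↔ x)) ∘ ∈.∈-++⁻ xs ,
           Sum.[ ∈.∈-++⁺ˡ ∘ proj₂ (xs↔ x) , ∈.∈-++⁺ʳ xs ∘ proj₂ (ys↔ x) ]) ,
    L.length-++ xs

  card-filter : ∀ {P : A → Set} (P? : Decidable P) (xs : List A) → Unique xs → (∀ x → x ∈ xs) →
                HasCard′ P (length (filter P? xs))
  card-filter P? xs !xs complete =
    filter P? xs , Unique.filter⁺ P? !xs ,
    (λ x → proj₂ ∘ ∈.∈-filter⁻ P? {xs = xs} , ∈.∈-filter⁺ P? (complete x)) , refl

module _ {A B : Set} where

  card-image : ∀ {P : A → Set} {N} (f : A → B) → Injective _≡_ _≡_ f → HasCard′ P N →
               HasCard′ (λ y → ∃ λ x → P x × f x ≡ y) N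
  card-image f f-inj (xs , !xs , xs↔ , len) =
    L.map f xs , Unique.map⁺ f-inj !xs ,
    (λ y → (λ y∈ → let x , x∈ , y≡fx = ∈.∈-map⁻ f y∈ in x , proj₁ (xs↔ x) x∈ , sym y≡fx) ,
           λ { (x , px , refl) → ∈.∈-map⁺ f (proj₂ (xs↔ x) px) }) ,
    trans (L.length-map f xs) len

length-cartesianProductWith : ∀ {A B C : Set} (f : A → B → C) xs ys →
  length (cartesianProductWith f xs ys) ≡ length xs * length ys
length-cartesianProductWith f L.[] ys = refl
length-cartesianProductWith f (x L.∷ xs) ys = begin
  length (L.map (f x) ys ++ cartesianProductWith f xs ys)
    ≡⟨ L.length-++ (L.map (f x) ys) ⟩
  length (L.map (f x) ys) + length (cartesianProductWith f xs ys)
    ≡⟨ cong₂ _+_ (L.length-map (f x) ys) (length-cartesianProductWith f xs ys) ⟩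
  length ys + length xs * length ys
    ∎
  where open ≡-Reasoning

card-pairing : ∀ {A B C : Set} {P : A → Set} {Q : B → Set} {N M} (g : A → B → C) →
  (∀ {a a′ b b′} → g a b ≡ g a′ b′ → a ≡ a′ × b ≡ b′) → HasCard′ P N → HasCard′ Q M →
  HasCard′ (λ z → ∃₂ λ a b → P a × Q b × g a b ≡ z) (N * M)
card-pairing g g-inj (xs , !xs , xs↔ , refl) (ys , !ys , ys↔ , refl) =
  cartesianProductWith g xs ys , Unique.cartesianProductWith⁺ g g-inj !xs !ys ,
  (λ z → (λ z∈ → let a , b , a∈ , b∈ , z≡gab = ∈.∈-cartesianProductWith⁻ g xs ys z∈
                  in a , b , proj₁ (xs↔ a) a∈ , proj₁ (ys↔ b) b∈ , sym z≡gab) ,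
         λ { (a , b , pa , qb , refl) → ∈.∈-cartesianProductWith⁺ g (proj₂ (xs↔ a) pa) (proj₂ (ys↔ b) qb) }) ,
  length-cartesianProductWith g xs ys

card-Fin : ∀ k → HasCard′ {Fin k} U k
card-Fin k = allFin k , Unique.allFin⁺ k , (λ i → (λ _ → tt) , λ _ → ∈.∈-allFin i) , L.length-tabulate {n = k} id

card-< : ∀ k → HasCard′ (_< k) k
card-< k = upTo k , Unique.upTo⁺ k , (λ _ → ∈.∈-upTo⁻ , ∈.∈-upTo⁺) , L.length-upTo k

card-interval : ∀ a k → HasCard′ (λ y → a ≤ y × y < k + a) k
card-interval a k = card-cong (shifted , unshift) (card-image (_+ a) (ℕ.+-cancelʳ-≡ a _ _) (card-< k))
  where
  shifted : ∀ {y} → (∃ λ x → x < k × x + a ≡ y) → a ≤ y × y < k + a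
  shifted (x , x<k , refl) = ℕ.m≤n+m a x , ℕ.+-monoˡ-< a x<k
  unshift : ∀ {y} → a ≤ y × y < k + a → ∃ λ x → x < k × x + a ≡ y
  unshift {y} (a≤y , y<k+a) =
    y ∸ a , ℕ.+-cancelʳ-< a _ _ (subst (_< k + a) (sym (ℕ.m∸n+n≡m a≤y)) y<k+a) , ℕ.m∸n+n≡m a≤y

card-decidable : ∀ {A : Set} {P : A → Set} {N} → DecidableEquality A → HasCard′ P N → Decidable P
card-decidable _≟_ (xs , _ , xs↔ , _) x = map′ (proj₁ (xs↔ x)) (proj₂ (xs↔ x)) (Any.any? (x ≟_) xs)

-- Vectors and positions

lookup-ext : ∀ {A : Set} {n} {xs ys : Vec A n} → (∀ i → lookup xs i ≡ lookup ys i) → xs ≡ ys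
lookup-ext {xs = xs} {ys} xs≗ys = begin
  xs                   ≡⟨ V.tabulate∘lookup xs ⟨
  tabulate (lookup xs) ≡⟨ V.tabulate-cong xs≗ys ⟩
  tabulate (lookup ys) ≡⟨ V.tabulate∘lookup ys ⟩
  ys                   ∎
  where open ≡-Reasoning

lookup-∷ʳ-inject₁ : ∀ {A : Set} {m} (xs : Vec A m) x i → lookup (xs ∷ʳ x) (inject₁ i) ≡ lookup xs i
lookup-∷ʳ-inject₁ (y ∷ xs) x F.zero    = refl
lookup-∷ʳ-inject₁ (y ∷ xs) x (F.suc i) = lookup-∷ʳ-inject₁ xs x i

lookup-∷ʳ-last : ∀ {A : Set} {m} (xs : Vec A m) x → lookup (xs ∷ʳ x) (fromℕ m) ≡ x
lookup-∷ʳ-last []       x = refl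
lookup-∷ʳ-last (y ∷ xs) x = lookup-∷ʳ-last xs x

∷ʳ-ext : ∀ {A : Set} {m} (σ : Vec A (suc m)) (xs : Vec A m) x →
  (∀ i → lookup σ (inject₁ i) ≡ lookup xs i) → lookup σ (fromℕ m) ≡ x → σ ≡ xs ∷ʳ x
∷ʳ-ext {m = m} σ xs x init≡ last≡ = lookup-ext (λ k → entry (view k))
  where
  entry : ∀ {k} → View k → lookup σ k ≡ lookup (xs ∷ʳ x) k
  entry ‵fromℕ       = trans last≡ (sym (lookup-∷ʳ-last xs x))
  entry (‵inject₁ i) = trans (init≡ i) (sym (lookup-∷ʳ-inject₁ xs x i))

fromℕ≮ : ∀ {m} (k : Fin (suc m)) → ¬ fromℕ m F.< k
fromℕ≮ k top<k = ℕ.<⇒≱ top<k (F.≤fromℕ k)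

inject₁-< : ∀ {m} {p q : Fin m} → p F.< q → inject₁ p F.< inject₁ q
inject₁-< {p = p} {q} = subst₂ ℕ._<_ (sym (F.toℕ-inject₁ p)) (sym (F.toℕ-inject₁ q))

inject₁-<⁻ : ∀ {m} {p q : Fin m} → inject₁ p F.< inject₁ q → p F.< q
inject₁-<⁻ {p = p} {q} = subst₂ ℕ._<_ (F.toℕ-inject₁ p) (F.toℕ-inject₁ q)

inject₁<fromℕ : ∀ {m} (i : Fin m) → inject₁ i F.< fromℕ m
inject₁<fromℕ {m} i = subst (toℕ (inject₁ i) ℕ.<_) (sym (F.toℕ-fromℕ m)) (F.inject₁ℕ< i)

transpose-matchˡ : ∀ {n} (i j : Fin n) → transpose i j i ≡ j
transpose-matchˡ i j rewrite dec-true (i F.≟ i) refl = refl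

transpose-matchʳ : ∀ {n} (i j : Fin n) → transpose i j j ≡ i
transpose-matchʳ i j with j F.≟ i
... | yes j≡i = j≡i
... | no _ rewrite dec-true (j F.≟ j) refl = refl

transpose-other : ∀ {n} {i j k : Fin n} → k ≢ i → k ≢ j → transpose i j k ≡ k
transpose-other {i = i} {j} {k} k≢i k≢j
  rewrite dec-false (k F.≟ i) k≢i | dec-false (k F.≟ j) k≢j = refl

transpose-injective : ∀ {n} (i j : Fin n) → Injective _≡_ _≡_ (transpose i j)
transpose-injective i j {k} {l} eq = begin
  k                               ≡⟨ transpose-inverse j i {k} ⟨
  transpose j i (transpose i j k) ≡⟨ cong (transpose j i) eq ⟩
  transpose j i (transpose i j l) ≡⟨ transpose-inverse j i {l} ⟩
  l                               ∎
  where open ≡-Reasoning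

-- Permutations and their cycles

perm-surjective : ∀ {n} (σ : Word n) → IsPerm σ → ∀ v → ∃ λ p → lookup σ p ≡ v
perm-surjective {suc m} σ σ-perm v with F.any? (λ p → lookup σ p F.≟ v)
... | yes hit = hit
... | no miss = contradiction (F.injective⇒≤ punchOut-injective) ℕ.1+n≰n
  where
  missed : ∀ p → v ≢ lookup σ p
  missed p v≡σp = miss (p , sym v≡σp)
  punchOut-injective : Injective _≡_ _≡_ (λ p → F.punchOut (missed p))
  punchOut-injective eq = σ-perm _ _ (F.punchOut-injective (missed _) (missed _) eq)

module _ {n} (σ : Word n) where

  iter-+ : ∀ p q x → iter σ (p + q) x ≡ iter σ p (iter σ q x)
  iter-+ zero    q x = refl
  iter-+ (suc p) q x = cong (lookup σ) (iter-+ p q x)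

  iter-periodic : ∀ {d x} → iter σ d x ≡ x → ∀ q → iter σ (q * d) x ≡ x
  iter-periodic         σᵈx≡x zero    = refl
  iter-periodic {d} {x} σᵈx≡x (suc q) =
    trans (iter-+ d (q * d) x) (trans (cong (iter σ d) (iter-periodic σᵈx≡x q)) σᵈx≡x)

  IsOrbitMin : Fin n → Set
  IsOrbitMin i = ∀ k → i F.≤ iter σ k i

module _ {n} {σ : Word n} (σ-perm : IsPerm σ) where

  iter-injective : ∀ p {y z} → iter σ p y ≡ iter σ p z → y ≡ z
  iter-injective zero    eq = eq
  iter-injective (suc p) eq = iter-injective p (σ-perm _ _ eq)

  iter-period : ∀ x → ∃ λ d → 0 < d × d ≤ n × iter σ d x ≡ x
  iter-period x with a , b , a<b , σᵃx≡σᵇx ← F.pigeonhole (ℕ.n<1+n n) (λ t → iter σ (toℕ t) x) =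
    d , ℕ.m<n⇒0<n∸m a<b , ℕ.≤-trans (ℕ.m∸n≤m (toℕ b) (toℕ a)) (ℕ.s≤s⁻¹ (F.toℕ<n b)) ,
    sym (iter-injective (toℕ a) (begin
      iter σ (toℕ a) x            ≡⟨ σᵃx≡σᵇx ⟩
      iter σ (toℕ b) x            ≡⟨ cong (λ t → iter σ t x) (ℕ.m+[n∸m]≡n (ℕ.<⇒≤ a<b)) ⟨
      iter σ (toℕ a + d) x        ≡⟨ iter-+ σ (toℕ a) d x ⟩
      iter σ (toℕ a) (iter σ d x) ∎))
    where
    open ≡-Reasoning
    d : ℕ
    d = toℕ b ∸ toℕ a

  iter-mod : ∀ x k → ∃ λ (k′ : Fin n) → iter σ k x ≡ iter σ (toℕ k′) x
  iter-mod x k with d , d>0 , d≤n , σᵈx≡x ← iter-period x =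
    fromℕ< k%d<n , (begin
      iter σ k x                                    ≡⟨ cong (λ t → iter σ t x) (m≡m%n+[m/n]*n k d) ⟩
      iter σ (k % d + k / d * d) x                  ≡⟨ iter-+ σ (k % d) (k / d * d) x ⟩
      iter σ (k % d) (iter σ (k / d * d) x)         ≡⟨ cong (iter σ (k % d)) (iter-periodic σ σᵈx≡x (k / d)) ⟩
      iter σ (k % d) x                              ≡⟨ cong (λ t → iter σ t x) (F.toℕ-fromℕ< k%d<n) ⟨
      iter σ (toℕ (fromℕ< k%d<n)) x                 ∎)
    where
    open ≡-Reasoning
    instance
      d≢0 : ℕ.NonZero d
      d≢0 = ℕ.>-nonZero d>0
    k%d<n : k % d < n
    k%d<n = ℕ.<-≤-trans (m%n<n k d) d≤n

  isCycleMin⇒isOrbitMin : ∀ {i} → IsCycleMin σ i → IsOrbitMin σ i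
  isCycleMin⇒isOrbitMin {i} min k with k′ , σᵏi≡σᵏ′i ← iter-mod i k =
    subst (i F.≤_) (sym σᵏi≡σᵏ′i) (min k′)

-- Stirling numbers of the first kind

module _ {m : ℕ} (π : Word m) where

  liftPerm : Fin (suc m) → Fin (suc m)
  liftPerm k with view k
  ... | ‵fromℕ     = fromℕ m
  ... | ‵inject₁ i = inject₁ (lookup π i)

  liftPerm-fromℕ : liftPerm (fromℕ m) ≡ fromℕ m
  liftPerm-fromℕ rewrite view-fromℕ m = refl

  liftPerm-inject₁ : ∀ i → liftPerm (inject₁ i) ≡ inject₁ (lookup π i)
  liftPerm-inject₁ i rewrite view-inject₁ i = refl

  liftPerm-≡fromℕ : ∀ {k} → liftPerm k ≡ fromℕ m → k ≡ fromℕ m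
  liftPerm-≡fromℕ {k} with view k
  ... | ‵fromℕ     = λ _ → refl
  ... | ‵inject₁ i = λ eq → contradiction (sym eq) F.fromℕ≢inject₁

  liftPerm-injective : IsPerm π → Injective _≡_ _≡_ liftPerm
  liftPerm-injective π-perm {k} {l} with view k | view l
  ... | ‵fromℕ     | ‵fromℕ     = λ _ → refl
  ... | ‵fromℕ     | ‵inject₁ _ = λ eq → contradiction eq F.fromℕ≢inject₁
  ... | ‵inject₁ _ | ‵fromℕ     = λ eq → contradiction (sym eq) F.fromℕ≢inject₁
  ... | ‵inject₁ i | ‵inject₁ j = cong inject₁ ∘ π-perm i j ∘ F.inject₁-injective

  liftPerm-unique : ∀ {f : Fin (suc m) → Fin (suc m)} → f (fromℕ m) ≡ fromℕ m →
                    (∀ i → f (inject₁ i) ≡ inject₁ (lookup π i)) → ∀ k → liftPerm k ≡ f k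
  liftPerm-unique f-top f-inject₁ k with view k
  ... | ‵fromℕ     = sym f-top
  ... | ‵inject₁ i = sym (f-inject₁ i)

-- insertMax π j = π ∘ (j m) inserts the new point m into the cycle of π right after j,
-- as a fixed point when j = m.
insertMax : ∀ {m} → Word m → Fin (suc m) → Word (suc m)
insertMax {m} π j = tabulate (liftPerm π ∘ transpose j (fromℕ m))

module _ {m} (π : Word m) (j : Fin (suc m)) where

  private
    σ = insertMax π j

  lookup-insertMax : ∀ k → lookup σ k ≡ liftPerm π (transpose j (fromℕ m) k)
  lookup-insertMax = V.lookup∘tabulate _

  insertMax-at : lookup σ j ≡ fromℕ m
  insertMax-at = begin
    lookup σ j                              ≡⟨ lookup-insertMax j ⟩
    liftPerm π (transpose j (fromℕ m) j)    ≡⟨ cong (liftPerm π) (transpose-matchˡ j (fromℕ m)) ⟩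
    liftPerm π (fromℕ m)                    ≡⟨ liftPerm-fromℕ π ⟩
    fromℕ m                                 ∎
    where open ≡-Reasoning

  insertMax-top : lookup σ (fromℕ m) ≡ liftPerm π j
  insertMax-top = trans (lookup-insertMax (fromℕ m)) (cong (liftPerm π) (transpose-matchʳ j (fromℕ m)))

  insertMax-inject₁ : ∀ i → inject₁ i ≢ j → lookup σ (inject₁ i) ≡ inject₁ (lookup π i)
  insertMax-inject₁ i i≢j = begin
    lookup σ (inject₁ i)                           ≡⟨ lookup-insertMax (inject₁ i) ⟩
    liftPerm π (transpose j (fromℕ m) (inject₁ i)) ≡⟨ cong (liftPerm π) (transpose-other i≢j (F.fromℕ≢inject₁ ∘ sym)) ⟩
    liftPerm π (inject₁ i)                         ≡⟨ liftPerm-inject₁ π i ⟩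
    inject₁ (lookup π i)                           ∎
    where open ≡-Reasoning

  insertMax-≡top : ∀ {k} → lookup σ k ≡ fromℕ m → k ≡ j
  insertMax-≡top {k} σk≡m = begin
    k                                               ≡⟨ transpose-inverse (fromℕ m) j {k} ⟨
    transpose (fromℕ m) j (transpose j (fromℕ m) k) ≡⟨ cong (transpose (fromℕ m) j) τk≡m ⟩
    transpose (fromℕ m) j (fromℕ m)                 ≡⟨ transpose-matchˡ (fromℕ m) j ⟩
    j                                               ∎
    where
    open ≡-Reasoning
    τk≡m : transpose j (fromℕ m) k ≡ fromℕ m
    τk≡m = liftPerm-≡fromℕ π (trans (sym (lookup-insertMax k)) σk≡m)

  liftPerm≡insertMax : ∀ k → liftPerm π k ≡ lookup σ (transpose (fromℕ m) j k)
  liftPerm≡insertMax k = trans (cong (liftPerm π) (sym (transpose-inverse j (fromℕ m) {k})))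
                               (sym (lookup-insertMax (transpose (fromℕ m) j k)))

  insertMax-perm : IsPerm π → IsPerm σ
  insertMax-perm π-perm k l σk≡σl = transpose-injective j (fromℕ m)
    (liftPerm-injective π π-perm (trans (sym (lookup-insertMax k)) (trans σk≡σl (lookup-insertMax l))))

insertMax-injective : ∀ {m} {π π′ : Word m} {j j′} → insertMax π j ≡ insertMax π′ j′ → j ≡ j′ × π ≡ π′
insertMax-injective {π = π} {π′} {j} {j′} σ≡σ′ = j≡j′ , lookup-ext π≗π′
  where
  j≡j′ : j ≡ j′
  j≡j′ = insertMax-≡top π′ j′ (trans (cong (λ σ → lookup σ j) (sym σ≡σ′)) (insertMax-at π j))
  π≗π′ : ∀ i → lookup π i ≡ lookup π′ i
  π≗π′ i with refl ← j≡j′ = F.inject₁-injective (begin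
    inject₁ (lookup π i)                     ≡⟨ liftPerm-inject₁ π i ⟨
    liftPerm π (inject₁ i)                   ≡⟨ liftPerm≡insertMax π j (inject₁ i) ⟩
    lookup (insertMax π j) (τ (inject₁ i))   ≡⟨ cong (λ σ → lookup σ (τ (inject₁ i))) σ≡σ′ ⟩
    lookup (insertMax π′ j) (τ (inject₁ i))  ≡⟨ liftPerm≡insertMax π′ j (inject₁ i) ⟨
    liftPerm π′ (inject₁ i)                  ≡⟨ liftPerm-inject₁ π′ i ⟩
    inject₁ (lookup π′ i)                    ∎)
    where
    open ≡-Reasoning
    τ : Fin (suc _) → Fin (suc _)
    τ = transpose (fromℕ _) j

module _ {m} (σ : Word (suc m)) (j : Fin (suc m)) (σ-perm : IsPerm σ) (σj≡m : lookup σ j ≡ fromℕ m) where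

  private
    σ′ : Fin m → Fin (suc m)
    σ′ i = lookup σ (transpose (fromℕ m) j (inject₁ i))

    σ′≢top : ∀ i → m ≢ toℕ (σ′ i)
    σ′≢top i m≡σ′i = F.fromℕ≢inject₁ (begin
      fromℕ m                                                     ≡⟨ transpose-matchˡ j (fromℕ m) ⟨
      transpose j (fromℕ m) j                                     ≡⟨ cong (transpose j (fromℕ m)) (σ-perm _ _ σ′i≡σj) ⟨
      transpose j (fromℕ m) (transpose (fromℕ m) j (inject₁ i))   ≡⟨ transpose-inverse j (fromℕ m) {inject₁ i} ⟩
      inject₁ i                                                   ∎)
      where
      open ≡-Reasoning
      σ′i≡σj : σ′ i ≡ lookup σ j
      σ′i≡σj = trans (F.toℕ-injective (trans (sym m≡σ′i) (sym (F.toℕ-fromℕ m)))) (sym σj≡m)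

  removeMax : Word m
  removeMax = tabulate λ i → F.lower₁ (σ′ i) (σ′≢top i)

  inject₁-removeMax : ∀ i → inject₁ (lookup removeMax i) ≡ σ′ i
  inject₁-removeMax i = trans (cong inject₁ (V.lookup∘tabulate _ i)) (F.inject₁-lower₁ (σ′ i) (σ′≢top i))

  removeMax-perm : IsPerm removeMax
  removeMax-perm i i′ eq = F.inject₁-injective (transpose-injective (fromℕ m) j
    (σ-perm _ _ (trans (sym (inject₁-removeMax i)) (trans (cong inject₁ eq) (inject₁-removeMax i′)))))

  insertMax-removeMax : insertMax removeMax j ≡ σ
  insertMax-removeMax = lookup-ext λ k → begin
    lookup (insertMax removeMax j) k
      ≡⟨ lookup-insertMax removeMax j k ⟩
    liftPerm removeMax (transpose j (fromℕ m) k)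
      ≡⟨ liftPerm-unique removeMax {σ∘τ} σ-top (sym ∘ inject₁-removeMax) (transpose j (fromℕ m) k) ⟩
    lookup σ (transpose (fromℕ m) j (transpose j (fromℕ m) k))
      ≡⟨ cong (lookup σ) (transpose-inverse (fromℕ m) j {k}) ⟩
    lookup σ k
      ∎
    where
    open ≡-Reasoning
    σ∘τ : Fin (suc m) → Fin (suc m)
    σ∘τ = lookup σ ∘ transpose (fromℕ m) j
    σ-top : lookup σ (transpose (fromℕ m) j (fromℕ m)) ≡ fromℕ m
    σ-top = trans (cong (lookup σ) (transpose-matchˡ (fromℕ m) j)) σj≡m

module _ {m} (π : Word m) (j : Fin (suc m)) where

  private
    σ = insertMax π j

  -- The σ-orbit of inject₁ i is the π-orbit of i, with m inserted after j if j lies on it.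
  insertMax-reaches : ∀ i k → ∃ λ k′ → iter σ k′ (inject₁ i) ≡ inject₁ (iter π k i)
  insertMax-reaches i zero = 0 , refl
  insertMax-reaches i (suc k) with k′ , σᵏ′i≡πᵏi ← insertMax-reaches i k | inject₁ (iter π k i) F.≟ j
  ... | no πᵏi≢j  = suc k′ , trans (cong (lookup σ) σᵏ′i≡πᵏi) (insertMax-inject₁ π j _ πᵏi≢j)
  ... | yes πᵏi≡j = suc (suc k′) , (begin
    lookup σ (lookup σ (iter σ k′ (inject₁ i)))  ≡⟨ cong (lookup σ ∘ lookup σ) σᵏ′i≡πᵏi ⟩
    lookup σ (lookup σ (inject₁ (iter π k i)))   ≡⟨ cong (lookup σ) (trans (cong (lookup σ) πᵏi≡j) (insertMax-at π j)) ⟩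
    lookup σ (fromℕ m)                           ≡⟨ insertMax-top π j ⟩
    liftPerm π j                                 ≡⟨ cong (liftPerm π) πᵏi≡j ⟨
    liftPerm π (inject₁ (iter π k i))            ≡⟨ liftPerm-inject₁ π _ ⟩
    inject₁ (iter π (suc k) i)                   ∎)
    where open ≡-Reasoning

  insertMax-orbit : ∀ i k → (∃ λ k′ → iter σ k (inject₁ i) ≡ inject₁ (iter π k′ i))
                          ⊎ (iter σ k (inject₁ i) ≡ fromℕ m × ∃ λ k′ → j ≡ inject₁ (iter π k′ i))
  insertMax-orbit i zero = inj₁ (0 , refl)
  insertMax-orbit i (suc k) with insertMax-orbit i k
  ... | inj₂ (σᵏi≡m , k′ , refl) =
    inj₁ (suc k′ , trans (cong (lookup σ) σᵏi≡m) (trans (insertMax-top π j) (liftPerm-inject₁ π _)))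
  ... | inj₁ (k′ , σᵏi≡πᵏ′i) with inject₁ (iter π k′ i) F.≟ j
  ...   | no πᵏ′i≢j = inj₁ (suc k′ , trans (cong (lookup σ) σᵏi≡πᵏ′i) (insertMax-inject₁ π j _ πᵏ′i≢j))
  ...   | yes refl  = inj₂ (trans (cong (lookup σ) σᵏi≡πᵏ′i) (insertMax-at π j) , k′ , refl)

  insertMax-orbitMin⁻ : ∀ i → IsOrbitMin σ (inject₁ i) → IsOrbitMin π i
  insertMax-orbitMin⁻ i min k with k′ , σᵏ′i≡πᵏi ← insertMax-reaches i k =
    subst₂ ℕ._≤_ (F.toℕ-inject₁ i) (trans (cong toℕ σᵏ′i≡πᵏi) (F.toℕ-inject₁ _)) (min k′)

  insertMax-orbitMin⁺ : ∀ i → IsOrbitMin π i → IsOrbitMin σ (inject₁ i)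
  insertMax-orbitMin⁺ i min k with insertMax-orbit i k
  ... | inj₁ (k′ , σᵏi≡πᵏ′i) =
    subst₂ ℕ._≤_ (sym (F.toℕ-inject₁ i)) (sym (trans (cong toℕ σᵏi≡πᵏ′i) (F.toℕ-inject₁ _))) (min k′)
  ... | inj₂ (σᵏi≡m , _) = subst (inject₁ i F.≤_) (sym σᵏi≡m) (F.≤fromℕ (inject₁ i))

  insertMax-top-cycleMin⁻ : IsPerm π → IsCycleMin σ (fromℕ m) → j ≡ fromℕ m
  insertMax-top-cycleMin⁻ π-perm min = liftPerm-≡fromℕ π (F.≤-antisym (F.≤fromℕ _) m≤π⁺j)
    where
    m≤π⁺j : fromℕ m F.≤ liftPerm π j
    m≤π⁺j = subst (fromℕ m F.≤_) (insertMax-top π j) (isCycleMin⇒isOrbitMin (insertMax-perm π j π-perm) min 1)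

  insertMax-top-cycleMin⁺ : j ≡ fromℕ m → IsCycleMin σ (fromℕ m)
  insertMax-top-cycleMin⁺ refl k = F.≤-reflexive (sym (fixed (toℕ k)))
    where
    fixed : ∀ k → iter σ k (fromℕ m) ≡ fromℕ m
    fixed zero    = refl
    fixed (suc k) = trans (cong (lookup σ) (fixed k)) (insertMax-at π j)

  insertMax-cycleMin : IsPerm π → IsCycleMin σ ≐
    ((λ k → ∃ λ i → IsCycleMin π i × inject₁ i ≡ k) ∪ (λ k → j ≡ fromℕ m × k ≡ fromℕ m))
  insertMax-cycleMin π-perm = to , from
    where
    to : ∀ {k} → IsCycleMin σ k → (∃ λ i → IsCycleMin π i × inject₁ i ≡ k) ⊎ (j ≡ fromℕ m × k ≡ fromℕ m)
    to {k} min with view k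
    ... | ‵fromℕ     = inj₂ (insertMax-top-cycleMin⁻ π-perm min , refl)
    ... | ‵inject₁ i = inj₁ (i , (λ k → insertMax-orbitMin⁻ i σ-orbitMin (toℕ k)) , refl)
      where
      σ-orbitMin : IsOrbitMin σ (inject₁ i)
      σ-orbitMin = isCycleMin⇒isOrbitMin (insertMax-perm π j π-perm) min
    from : ∀ {k} → (∃ λ i → IsCycleMin π i × inject₁ i ≡ k) ⊎ (j ≡ fromℕ m × k ≡ fromℕ m) → IsCycleMin σ k
    from (inj₁ (i , min , refl)) k = insertMax-orbitMin⁺ i (isCycleMin⇒isOrbitMin π-perm min) (toℕ k)
    from (inj₂ (j≡m , refl))       = insertMax-top-cycleMin⁺ j≡m

cycleMin-card : ∀ {n} (σ : Word n) → HasCard′ (IsCycleMin σ) (numCycles σ)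
cycleMin-card {n} σ = card-filter (isCycleMin? σ) (allFin n) (Unique.allFin⁺ n) ∈.∈-allFin

numCycles-insertMax : ∀ {m} (π : Word m) j {t} → IsPerm π →
  HasCard′ (λ k → j ≡ fromℕ m × k ≡ fromℕ m) t → numCycles (insertMax π j) ≡ numCycles π + t
numCycles-insertMax π j π-perm top-card = card-unique (cycleMin-card (insertMax π j))
  (card-cong (≐-sym (insertMax-cycleMin π j π-perm))
    (card-∪ (card-image inject₁ F.inject₁-injective (cycleMin-card π)) top-card
      λ (_ , _ , i≡k) (_ , k≡m) → F.fromℕ≢inject₁ (trans (sym k≡m) (sym i≡k))))

numCycles-insertMax-inject₁ : ∀ {m} (π : Word m) i → IsPerm π → numCycles (insertMax π (inject₁ i)) ≡ numCycles π
numCycles-insertMax-inject₁ π i π-perm =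
  trans (numCycles-insertMax π (inject₁ i) π-perm (card-∅ λ _ (i≡m , _) → F.fromℕ≢inject₁ (sym i≡m)))
        (ℕ.+-identityʳ _)

numCycles-insertMax-top : ∀ {m} (π : Word m) → IsPerm π → numCycles (insertMax π (fromℕ m)) ≡ suc (numCycles π)
numCycles-insertMax-top {m} π π-perm =
  trans (numCycles-insertMax π (fromℕ m) π-perm top-card) (ℕ.+-comm _ 1)
  where
  top-card : HasCard′ (λ k → fromℕ m ≡ fromℕ m × k ≡ fromℕ m) 1
  top-card = L.[ fromℕ m ] , All.[] AllPairs.∷ AllPairs.[] ,
    (λ k → (λ { (here refl) → refl , refl }) , λ { (_ , refl) → here refl }) , refl

concatMap-map≡cartesianProductWith : ∀ {A B C : Set} (f : A → B → C) xs ys →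
  L.concatMap (λ x → L.map (f x) ys) xs ≡ cartesianProductWith f xs ys
concatMap-map≡cartesianProductWith f L.[]       ys = refl
concatMap-map≡cartesianProductWith f (x L.∷ xs) ys =
  cong (L.map (f x) ys ++_) (concatMap-map≡cartesianProductWith f xs ys)

allWords-unique : ∀ {n} m → Unique (allWords {n} m)
allWords-unique zero = All.[] AllPairs.∷ AllPairs.[]
allWords-unique {n} (suc m) =
  subst Unique (sym (concatMap-map≡cartesianProductWith _∷_ (allFin n) (allWords m)))
    (Unique.cartesianProductWith⁺ _∷_ V.∷-injective (Unique.allFin⁺ n) (allWords-unique m))

∈-allWords : ∀ {n} m (v : Vec (Fin n) m) → v ∈ allWords m
∈-allWords zero    []      = here refl
∈-allWords {n} (suc m) (x ∷ v) =
  subst (x ∷ v ∈_) (sym (concatMap-map≡cartesianProductWith _∷_ (allFin n) (allWords m)))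
    (∈.∈-cartesianProductWith⁺ _∷_ (∈.∈-allFin x) (∈-allWords m v))

PermWithCycles : ∀ m → ℕ → Word m → Set
PermWithCycles m r σ = IsPerm σ × numCycles σ ≡ r

stirling1-card : ∀ m r → HasCard′ (PermWithCycles m r) (stirling1 m r)
stirling1-card m r = card-filter (λ σ → isPerm? σ ×-dec (numCycles σ ℕ.≟ r))
  (allWords m) (allWords-unique m) (∈-allWords m)

stirling1-suc-zero : ∀ m → stirling1 (suc m) 0 ≡ 0
stirling1-suc-zero m = card-unique (stirling1-card (suc m) 0)
  (card-∅ λ σ (_ , c≡0) → ℕ.1+n≢0 (trans (sym (zero-counted σ)) c≡0))
  where
  zero-counted : ∀ σ → numCycles σ ≡ suc _
  zero-counted σ = cong length (L.filter-accept (isCycleMin? σ) {xs = L.tabulate F.suc} (λ _ → z≤n))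

stirling1-> : ∀ m r → m < r → stirling1 m r ≡ 0
stirling1-> m r m<r = card-unique (stirling1-card m r) (card-∅ λ σ (_ , c≡r) →
  ℕ.<⇒≱ m<r (subst (_≤ m) c≡r (ℕ.≤-trans (L.length-filter (isCycleMin? σ) (allFin m))
                                          (ℕ.≤-reflexive (L.length-tabulate id)))))

-- Every σ ∈ 𝔖_{m+1} is insertMax π j for exactly one pair (π, j), and m is a new cycle iff j = m.
stirling1-suc-suc : ∀ m r → stirling1 (suc m) (suc r) ≡ m * stirling1 m (suc r) + stirling1 m r
stirling1-suc-suc m r = card-unique (stirling1-card (suc m) (suc r))
  (card-cong (to , from) (card-∪ inserted fixedTop disjoint))
  where
  Inserted FixedTop : Word (suc m) → Set
  Inserted σ = ∃₂ λ i π → U i × PermWithCycles m (suc r) π × insertMax π (inject₁ i) ≡ σ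
  FixedTop σ = ∃ λ π → PermWithCycles m r π × insertMax π (fromℕ m) ≡ σ

  inserted : HasCard′ Inserted (m * stirling1 m (suc r))
  inserted = card-pairing (λ i π → insertMax π (inject₁ i))
    (λ {i} {i′} {π} {π′} → Product.map₁ F.inject₁-injective ∘ insertMax-injective {π = π} {π′} {inject₁ i} {inject₁ i′})
    (card-Fin m) (stirling1-card m (suc r))

  fixedTop : HasCard′ FixedTop (stirling1 m r)
  fixedTop = card-image (λ π → insertMax π (fromℕ m))
    (λ {π} {π′} → proj₂ ∘ insertMax-injective {π = π} {π′} {fromℕ m} {fromℕ m}) (stirling1-card m r)

  disjoint : ∀ {σ} → Inserted σ → ¬ FixedTop σ
  disjoint (i , π , _ , _ , σ≡) (π′ , _ , σ≡′) =
    F.fromℕ≢inject₁ (sym (proj₁ (insertMax-injective {π = π} {π′} {inject₁ i} {fromℕ m} (trans σ≡ (sym σ≡′)))))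

  to : ∀ {σ} → Inserted σ ⊎ FixedTop σ → PermWithCycles (suc m) (suc r) σ
  to (inj₁ (i , π , _ , (π-perm , c≡) , refl)) =
    insertMax-perm π (inject₁ i) π-perm , trans (numCycles-insertMax-inject₁ π i π-perm) c≡
  to (inj₂ (π , (π-perm , c≡) , refl)) =
    insertMax-perm π (fromℕ m) π-perm , trans (numCycles-insertMax-top π π-perm) (cong suc c≡)

  decompose : ∀ {σ π j} → View j → IsPerm π → insertMax π j ≡ σ → numCycles σ ≡ suc r →
              Inserted σ ⊎ FixedTop σ
  decompose ‵fromℕ       π-perm refl c≡ =
    inj₂ (_ , (π-perm , ℕ.suc-injective (trans (sym (numCycles-insertMax-top _ π-perm)) c≡)) , refl)
  decompose (‵inject₁ i) π-perm refl c≡ =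
    inj₁ (i , _ , _ , (π-perm , trans (sym (numCycles-insertMax-inject₁ _ i π-perm)) c≡) , refl)

  from : ∀ {σ} → PermWithCycles (suc m) (suc r) σ → Inserted σ ⊎ FixedTop σ
  from {σ} (σ-perm , c≡) with j , σj≡m ← perm-surjective σ σ-perm (fromℕ m) =
    decompose (view j) (removeMax-perm σ j σ-perm σj≡m) (insertMax-removeMax σ j σ-perm σj≡m) c≡

-- The polynomials a_n

rising-suc : ∀ x r → rising x (suc r) ≡ x * rising (suc x) r
rising-suc x zero = trans (ℕ.*-identityˡ (x + 0)) (trans (ℕ.+-identityʳ x) (sym (ℕ.*-identityʳ x)))
rising-suc x (suc r) = begin
  rising x (suc r) * (x + suc r)       ≡⟨ cong₂ _*_ (rising-suc x r) (ℕ.+-suc x r) ⟩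
  x * rising (suc x) r * (suc x + r)   ≡⟨ ℕ.*-assoc x _ _ ⟩
  x * rising (suc x) (suc r)           ∎
  where open ≡-Reasoning

-- Unlike aPoly, aPoly′ includes the term r = 0, which vanishes for m ≥ 1.
aPoly′ : ℕ → ℕ → ℕ
aPoly′ m x = ∑[ r ≤ m ] (stirling1 m (toℕ r) * rising x (toℕ r))

listSum-applyUpTo : ∀ (f : ℕ → ℕ) k → sum (L.applyUpTo f k) ≡ ∑[ i < k ] f (toℕ i)
listSum-applyUpTo f zero    = refl
listSum-applyUpTo f (suc k) = cong (f 0 +_) (listSum-applyUpTo (f ∘ suc) k)

aPoly≡aPoly′ : ∀ n x → aPoly (suc n) x ≡ aPoly′ (suc n) x
aPoly≡aPoly′ n x = begin
  sum (L.map term (L.map suc (upTo (suc n))))  ≡⟨ cong (sum ∘ L.map term) (L.map-applyUpTo id suc (suc n)) ⟩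
  sum (L.map term (L.applyUpTo suc (suc n)))   ≡⟨ cong sum (L.map-applyUpTo suc term (suc n)) ⟩
  sum (L.applyUpTo (term ∘ suc) (suc n))       ≡⟨ listSum-applyUpTo (term ∘ suc) (suc n) ⟩
  ∑[ r < suc n ] term (suc (toℕ r))
    ≡⟨ cong (λ s → s * 1 + ∑[ r < suc n ] term (suc (toℕ r))) (stirling1-suc-zero n) ⟨
  aPoly′ (suc n) x
    ∎
  where
  open ≡-Reasoning
  term : ℕ → ℕ
  term r = stirling1 (suc n) r * rising x r

*-stirling1-zero : ∀ m → m * stirling1 m 0 ≡ 0
*-stirling1-zero zero    = refl
*-stirling1-zero (suc m) = trans (cong (suc m *_) (stirling1-suc-zero m)) (ℕ.*-zeroʳ (suc m))

-- The factor m kills the r = 0 term of aPoly′ m x, which is nonzero only for m = 0.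
aPoly′-tail-scaled : ∀ m x →
  m * (∑[ r ≤ m ] (stirling1 m (suc (toℕ r)) * rising x (suc (toℕ r)))) ≡ m * aPoly′ m x
aPoly′-tail-scaled m x = begin
  m * tail                      ≡⟨ cong (_+ m * tail) m*s₀≡0 ⟨
  m * (s₀ * 1) + m * tail       ≡⟨ ℕ.*-distribˡ-+ m (s₀ * 1) tail ⟨
  m * (s₀ * 1 + tail)           ≡⟨ cong (m *_) (sum-init-last {suc m} term) ⟩
  m * (∑[ r ≤ m ] term (inject₁ r) + term (fromℕ (suc m)))
    ≡⟨ cong (m *_) (cong₂ _+_ (sum-cong-≗ {suc m} (cong term′ ∘ F.toℕ-inject₁)) top-vanishes) ⟩
  m * (aPoly′ m x + 0)          ≡⟨ cong (m *_) (ℕ.+-identityʳ _) ⟩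
  m * aPoly′ m x                ∎
  where
  open ≡-Reasoning
  term′ : ℕ → ℕ
  term′ r = stirling1 m r * rising x r
  term : Fin (suc (suc m)) → ℕ
  term = term′ ∘ toℕ
  s₀ tail : ℕ
  s₀ = stirling1 m 0
  tail = ∑[ r ≤ m ] (stirling1 m (suc (toℕ r)) * rising x (suc (toℕ r)))
  m*s₀≡0 : m * (s₀ * 1) ≡ 0
  m*s₀≡0 = trans (cong (m *_) (ℕ.*-identityʳ s₀)) (*-stirling1-zero m)
  top-vanishes : term (fromℕ (suc m)) ≡ 0
  top-vanishes rewrite F.toℕ-fromℕ (suc m) | stirling1-> m (suc m) (ℕ.n<1+n m) = refl

stirling1-rising-suc : ∀ m r x → stirling1 (suc m) (suc r) * rising x (suc r)
  ≡ m * (stirling1 m (suc r) * rising x (suc r)) + x * (stirling1 m r * rising (suc x) r)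
stirling1-rising-suc m r x = begin
  stirling1 (suc m) (suc r) * R                     ≡⟨ cong (_* R) (stirling1-suc-suc m r) ⟩
  (m * s + t) * R                                   ≡⟨ ℕ.*-distribʳ-+ R (m * s) t ⟩
  m * s * R + t * R                                 ≡⟨ cong₂ _+_ (ℕ.*-assoc m s R) (cong (t *_) (rising-suc x r)) ⟩
  m * (s * R) + t * (x * rising (suc x) r)          ≡⟨ cong (m * (s * R) +_) (x∙yz≈y∙xz t x _) ⟩
  m * (s * R) + x * (t * rising (suc x) r)          ∎
  where
  open ≡-Reasoning
  R s t : ℕ
  R = rising x (suc r)
  s = stirling1 m (suc r)
  t = stirling1 m r

aPoly′-suc : ∀ m x → aPoly′ (suc m) x ≡ aPoly′ m (suc x) * x + aPoly′ m x * m
aPoly′-suc m x = begin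
  stirling1 (suc m) 0 * 1 + ∑[ r ≤ m ] (stirling1 (suc m) (suc (toℕ r)) * rising x (suc (toℕ r)))
    ≡⟨ cong₂ _+_ (cong (_* 1) (stirling1-suc-zero m)) (sum-cong-≗ {suc m} (λ r → stirling1-rising-suc m (toℕ r) x)) ⟩
  ∑[ r ≤ m ] (m * A r + x * B r)
    ≡⟨ ∑-distrib-+ {suc m} (λ r → m * A r) (λ r → x * B r) ⟩
  ∑[ r ≤ m ] (m * A r) + ∑[ r ≤ m ] (x * B r)
    ≡⟨ cong₂ _+_ (*-distribˡ-sum {suc m} m A) (*-distribˡ-sum {suc m} x B) ⟨
  m * (∑[ r ≤ m ] A r) + x * aPoly′ m (suc x)
    ≡⟨ cong (_+ x * aPoly′ m (suc x)) (aPoly′-tail-scaled m x) ⟩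
  m * aPoly′ m x + x * aPoly′ m (suc x)
    ≡⟨ ℕ.+-comm (m * aPoly′ m x) _ ⟩
  x * aPoly′ m (suc x) + m * aPoly′ m x
    ≡⟨ cong₂ _+_ (ℕ.*-comm x _) (ℕ.*-comm m _) ⟩
  aPoly′ m (suc x) * x + aPoly′ m x * m
    ∎
  where
  open ≡-Reasoning
  A B : Fin (suc m) → ℕ
  A r = stirling1 m (suc (toℕ r)) * rising x (suc (toℕ r))
  B r = stirling1 m (toℕ r) * rising (suc x) (toℕ r)

-- Permutations avoiding 132 and 312

Avoids132 Avoids312 : ∀ {n} → Word n → Set
Avoids132 σ = ∀ {p q r} → p F.< q → q F.< r → lookup σ p F.< lookup σ r → ¬ lookup σ r F.< lookup σ q
Avoids312 σ = ∀ {p q r} → p F.< q → q F.< r → lookup σ q F.< lookup σ r → ¬ lookup σ r F.< lookup σ p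

InW′ : ∀ {n} → Word n → Set
InW′ σ = IsPerm σ × Avoids132 σ × Avoids312 σ

private
  triple : ∀ {n} → Fin n → Fin n → Fin n → Fin 3 → Fin n
  triple p q r F.zero                   = p
  triple p q r (F.suc F.zero)           = q
  triple p q r (F.suc (F.suc F.zero))   = r

  triple-monotone : ∀ {n} {p q r : Fin n} → p F.< q → q F.< r → ∀ a b → a F.< b → triple p q r a F.< triple p q r b
  triple-monotone p<q q<r F.zero           (F.suc F.zero)         _ = p<q
  triple-monotone p<q q<r F.zero           (F.suc (F.suc F.zero)) _ = ℕ.<-trans p<q q<r
  triple-monotone p<q q<r (F.suc F.zero)   (F.suc (F.suc F.zero)) _ = q<r
  triple-monotone p<q q<r F.zero           F.zero                 ()
  triple-monotone p<q q<r (F.suc F.zero)   F.zero                 ()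
  triple-monotone p<q q<r (F.suc F.zero)   (F.suc F.zero)         (s≤s ())
  triple-monotone p<q q<r (F.suc (F.suc F.zero)) F.zero           ()
  triple-monotone p<q q<r (F.suc (F.suc F.zero)) (F.suc F.zero)   (s≤s ())
  triple-monotone p<q q<r (F.suc (F.suc F.zero)) (F.suc (F.suc F.zero)) (s≤s (s≤s ()))

order-iso : ∀ {n r} (σ : Word n) (τ : Word r) → IsPerm τ → (f : Fin r → Fin n) →
  (∀ a b → lookup τ a F.< lookup τ b → lookup σ (f a) F.< lookup σ (f b)) →
  ∀ a b → (lookup σ (f a) F.< lookup σ (f b) → lookup τ a F.< lookup τ b)
        × (lookup τ a F.< lookup τ b → lookup σ (f a) F.< lookup σ (f b))
order-iso σ τ τ-perm f preserves a b = reflects , preserves a b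
  where
  reflects : lookup σ (f a) F.< lookup σ (f b) → lookup τ a F.< lookup τ b
  reflects σfa<σfb with F.<-cmp (lookup τ a) (lookup τ b)
  ... | tri< τa<τb _ _ = τa<τb
  ... | tri≈ _ τa≡τb _ = contradiction (cong (lookup σ ∘ f) (τ-perm a b τa≡τb)) (F.<⇒≢ σfa<σfb)
  ... | tri> _ _ τb<τa = contradiction σfa<σfb (ℕ.<-asym (preserves b a τb<τa))

contains132 : ∀ {n} (σ : Word n) {p q r} → p F.< q → q F.< r →
  lookup σ p F.< lookup σ r → lookup σ r F.< lookup σ q → Contains σ p132
contains132 σ {p} {q} {r} p<q q<r σp<σr σr<σq =
  triple p q r , triple-monotone p<q q<r , order-iso σ p132 (toWitness {a? = isPerm? p132} _) (triple p q r) preserves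
  where
  preserves : ∀ a b → lookup p132 a F.< lookup p132 b → lookup σ (triple p q r a) F.< lookup σ (triple p q r b)
  preserves F.zero                 (F.suc F.zero)         _ = ℕ.<-trans σp<σr σr<σq
  preserves F.zero                 (F.suc (F.suc F.zero)) _ = σp<σr
  preserves (F.suc (F.suc F.zero)) (F.suc F.zero)         _ = σr<σq
  preserves F.zero                 F.zero                 ()
  preserves (F.suc F.zero)         F.zero                 ()
  preserves (F.suc F.zero)         (F.suc F.zero)         (s≤s (s≤s ()))
  preserves (F.suc F.zero)         (F.suc (F.suc F.zero)) (s≤s ())
  preserves (F.suc (F.suc F.zero)) F.zero                 ()
  preserves (F.suc (F.suc F.zero)) (F.suc (F.suc F.zero)) (s≤s ())

contains312 : ∀ {n} (σ : Word n) {p q r} → p F.< q → q F.< r →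
  lookup σ q F.< lookup σ r → lookup σ r F.< lookup σ p → Contains σ p312
contains312 σ {p} {q} {r} p<q q<r σq<σr σr<σp =
  triple p q r , triple-monotone p<q q<r , order-iso σ p312 (toWitness {a? = isPerm? p312} _) (triple p q r) preserves
  where
  preserves : ∀ a b → lookup p312 a F.< lookup p312 b → lookup σ (triple p q r a) F.< lookup σ (triple p q r b)
  preserves (F.suc F.zero)         F.zero                 _ = ℕ.<-trans σq<σr σr<σp
  preserves (F.suc F.zero)         (F.suc (F.suc F.zero)) _ = σq<σr
  preserves (F.suc (F.suc F.zero)) F.zero                 _ = σr<σp
  preserves F.zero                 F.zero                 (s≤s (s≤s ()))
  preserves F.zero                 (F.suc F.zero)         ()
  preserves F.zero                 (F.suc (F.suc F.zero)) (s≤s ())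
  preserves (F.suc F.zero)         (F.suc F.zero)         ()
  preserves (F.suc (F.suc F.zero)) (F.suc F.zero)         ()
  preserves (F.suc (F.suc F.zero)) (F.suc (F.suc F.zero)) (s≤s ())

module _ {n} (σ : Word n) where

  avoids132⇒avoids : Avoids132 σ → Avoids σ p132
  avoids132⇒avoids avoids (f , mono , iso) = avoids (mono (# 0) (# 1) (s≤s z≤n)) (mono (# 1) (# 2) (s≤s (s≤s z≤n)))
    (proj₂ (iso (# 0) (# 2)) (s≤s z≤n)) (proj₂ (iso (# 2) (# 1)) (s≤s (s≤s z≤n)))

  avoids312⇒avoids : Avoids312 σ → Avoids σ p312
  avoids312⇒avoids avoids (f , mono , iso) = avoids (mono (# 0) (# 1) (s≤s z≤n)) (mono (# 1) (# 2) (s≤s (s≤s z≤n)))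
    (proj₂ (iso (# 1) (# 2)) (s≤s z≤n)) (proj₂ (iso (# 2) (# 0)) (s≤s (s≤s z≤n)))

inW⇒inW′ : ∀ {n} (σ : Word n) → InW σ → InW′ σ
inW⇒inW′ σ (σ-perm , ¬132 , ¬312) =
  σ-perm , (λ p<q q<r σp<σr σr<σq → ¬132 (contains132 σ p<q q<r σp<σr σr<σq))
         , (λ p<q q<r σq<σr σr<σp → ¬312 (contains312 σ p<q q<r σq<σr σr<σp))

inW′⇒inW : ∀ {n} (σ : Word n) → InW′ σ → InW σ
inW′⇒inW σ (σ-perm , avoids132 , avoids312) = σ-perm , avoids132⇒avoids σ avoids132 , avoids312⇒avoids σ avoids312

Shifted : ∀ {m} → Word (suc m) → Word m → ℕ → Set
Shifted σ τ δ = ∀ i → toℕ (lookup σ (inject₁ i)) ≡ δ + toℕ (lookup τ i)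

LastExtreme : ∀ {m} → Word (suc m) → ℕ → Set
LastExtreme {m} σ δ = (δ ≡ 1 × toℕ (lookup σ (fromℕ m)) ≡ 0) ⊎ (δ ≡ 0 × toℕ (lookup σ (fromℕ m)) ≡ m)

module _ {m} (σ : Word (suc m)) (τ : Word m) (δ : ℕ) (shift : Shifted σ τ δ) where

  shifted-< : ∀ {a b} → lookup τ a F.< lookup τ b → lookup σ (inject₁ a) F.< lookup σ (inject₁ b)
  shifted-< {a} {b} τa<τb rewrite shift a | shift b = ℕ.+-monoʳ-< δ τa<τb

  shifted-<⁻ : ∀ {a b} → lookup σ (inject₁ a) F.< lookup σ (inject₁ b) → lookup τ a F.< lookup τ b
  shifted-<⁻ {a} {b} σa<σb rewrite shift a | shift b = ℕ.+-cancelˡ-< δ _ _ σa<σb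

  shifted-inW′⁻ : InW′ σ → InW′ τ
  shifted-inW′⁻ (σ-perm , avoids132 , avoids312) =
    τ-perm ,
    (λ p<q q<r v₁ v₂ → avoids132 (inject₁-< p<q) (inject₁-< q<r) (shifted-< v₁) (shifted-< v₂)) ,
    (λ p<q q<r v₁ v₂ → avoids312 (inject₁-< p<q) (inject₁-< q<r) (shifted-< v₁) (shifted-< v₂))
    where
    τ-perm : IsPerm τ
    τ-perm i j τi≡τj = F.inject₁-injective (σ-perm _ _ (F.toℕ-injective
      (trans (shift i) (trans (cong (λ t → δ + toℕ t) τi≡τj) (sym (shift j))))))

  private
    top : Fin (suc m)
    top = fromℕ m

    last-not-between : LastExtreme σ δ → ∀ {k k′} → lookup σ k F.< lookup σ top → ¬ lookup σ top F.< lookup σ k′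
    last-not-between (inj₁ (_ , σtop≡0)) {k} σk<σtop _ =
      ℕ.n≮0 (subst (toℕ (lookup σ k) ℕ.<_) σtop≡0 σk<σtop)
    last-not-between (inj₂ (_ , σtop≡m)) {k′ = k′} _ σtop<σk′ =
      ℕ.<⇒≱ (subst (ℕ._< toℕ (lookup σ k′)) σtop≡m σtop<σk′) (ℕ.s≤s⁻¹ (F.toℕ<n (lookup σ k′)))

    inject₁≢top : LastExtreme σ δ → ∀ i → lookup σ (inject₁ i) ≢ lookup σ top
    inject₁≢top (inj₁ (refl , σtop≡0)) i σi≡σtop =
      ℕ.1+n≢0 (trans (sym (shift i)) (trans (cong toℕ σi≡σtop) σtop≡0))
    inject₁≢top (inj₂ (refl , σtop≡m)) i σi≡σtop =
      ℕ.<-irrefl (trans (sym (shift i)) (trans (cong toℕ σi≡σtop) σtop≡m)) (F.toℕ<n (lookup τ i))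

  module _ (extreme : LastExtreme σ δ) where

    shifted-perm : IsPerm τ → IsPerm σ
    shifted-perm τ-perm k l σk≡σl with view k | view l
    ... | ‵fromℕ     | ‵fromℕ     = refl
    ... | ‵inject₁ i | ‵fromℕ     = contradiction σk≡σl (inject₁≢top extreme i)
    ... | ‵fromℕ     | ‵inject₁ j = contradiction (sym σk≡σl) (inject₁≢top extreme j)
    ... | ‵inject₁ i | ‵inject₁ j = cong inject₁ (τ-perm i j (F.toℕ-injective
      (ℕ.+-cancelˡ-≡ δ _ _ (trans (sym (shift i)) (trans (cong toℕ σk≡σl) (shift j))))))

    shifted-avoids132 : Avoids132 τ → Avoids132 σ
    shifted-avoids132 avoids {p} {q} {r} p<q q<r v₁ v₂ with view r | view q | view p
    ... | ‵fromℕ      | _           | _           = last-not-between extreme v₁ v₂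
    ... | ‵inject₁ _  | ‵fromℕ      | _           = fromℕ≮ _ q<r
    ... | ‵inject₁ _  | ‵inject₁ _  | ‵fromℕ      = fromℕ≮ _ p<q
    ... | ‵inject₁ _  | ‵inject₁ _  | ‵inject₁ _  =
      avoids (inject₁-<⁻ p<q) (inject₁-<⁻ q<r) (shifted-<⁻ v₁) (shifted-<⁻ v₂)

    shifted-avoids312 : Avoids312 τ → Avoids312 σ
    shifted-avoids312 avoids {p} {q} {r} p<q q<r v₁ v₂ with view r | view q | view p
    ... | ‵fromℕ      | _           | _           = last-not-between extreme v₁ v₂
    ... | ‵inject₁ _  | ‵fromℕ      | _           = fromℕ≮ _ q<r
    ... | ‵inject₁ _  | ‵inject₁ _  | ‵fromℕ      = fromℕ≮ _ p<q
    ... | ‵inject₁ _  | ‵inject₁ _  | ‵inject₁ _  =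
      avoids (inject₁-<⁻ p<q) (inject₁-<⁻ q<r) (shifted-<⁻ v₁) (shifted-<⁻ v₂)

    shifted-inW′ : InW′ τ → InW′ σ
    shifted-inW′ (τ-perm , avoids132 , avoids312) =
      shifted-perm τ-perm , shifted-avoids132 avoids132 , shifted-avoids312 avoids312

appendMax appendMin : ∀ {m} → Word m → Word (suc m)
appendMax {m} τ = V.map inject₁ τ ∷ʳ fromℕ m
appendMin     τ = V.map F.suc τ ∷ʳ F.zero

appendMax-shifted : ∀ {m} (τ : Word m) → Shifted (appendMax τ) τ 0
appendMax-shifted τ i rewrite lookup-∷ʳ-inject₁ (V.map inject₁ τ) (fromℕ _) i | V.lookup-map i inject₁ τ =
  F.toℕ-inject₁ (lookup τ i)

appendMin-shifted : ∀ {m} (τ : Word m) → Shifted (appendMin τ) τ 1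
appendMin-shifted τ i rewrite lookup-∷ʳ-inject₁ (V.map F.suc τ) F.zero i | V.lookup-map i F.suc τ = refl

appendMax-last : ∀ {m} (τ : Word m) → toℕ (lookup (appendMax τ) (fromℕ m)) ≡ m
appendMax-last {m} τ = trans (cong toℕ (lookup-∷ʳ-last (V.map inject₁ τ) (fromℕ m))) (F.toℕ-fromℕ m)

appendMin-last : ∀ {m} (τ : Word m) → toℕ (lookup (appendMin τ) (fromℕ m)) ≡ 0
appendMin-last τ = cong toℕ (lookup-∷ʳ-last (V.map F.suc τ) F.zero)

inW′-appendMax : ∀ {m} {τ : Word m} → InW′ τ → InW′ (appendMax τ)
inW′-appendMax {τ = τ} = shifted-inW′ (appendMax τ) τ 0 (appendMax-shifted τ) (inj₂ (refl , appendMax-last τ))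

inW′-appendMin : ∀ {m} {τ : Word m} → InW′ τ → InW′ (appendMin τ)
inW′-appendMin {τ = τ} = shifted-inW′ (appendMin τ) τ 1 (appendMin-shifted τ) (inj₁ (refl , appendMin-last τ))

-- If the last entry v were neither 0 nor m, then 0, m, v or m, 0, v would be a 132 or a 312.
inW′-last-extreme : ∀ {m} (σ : Word (suc m)) → InW′ σ →
  toℕ (lookup σ (fromℕ m)) ≡ 0 ⊎ toℕ (lookup σ (fromℕ m)) ≡ m
inW′-last-extreme {m} σ (σ-perm , avoids132 , avoids312)
  with toℕ (lookup σ (fromℕ m)) ℕ.≟ 0 | toℕ (lookup σ (fromℕ m)) ℕ.≟ m
... | yes v≡0 | _       = inj₁ v≡0
... | no _    | yes v≡m = inj₂ v≡m
... | no v≢0  | no v≢m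
  with p , σp≡0 ← perm-surjective σ σ-perm F.zero | q , σq≡m ← perm-surjective σ σ-perm (fromℕ m) =
  ⊥-elim (impossible (view p) (view q) σp≡0 σq≡m)
  where
  0<v : F.zero {m} F.< lookup σ (fromℕ m)
  0<v = ℕ.n≢0⇒n>0 v≢0
  v<m : lookup σ (fromℕ m) F.< fromℕ m
  v<m = subst (toℕ (lookup σ (fromℕ m)) ℕ.<_) (sym (F.toℕ-fromℕ m)) (ℕ.≤∧≢⇒< (ℕ.s≤s⁻¹ (F.toℕ<n _)) v≢m)
  impossible : ∀ {p q} → View p → View q → lookup σ p ≡ F.zero → lookup σ q ≡ fromℕ m → ⊥
  impossible ‵fromℕ       _            σp≡0 _    = v≢0 (cong toℕ σp≡0)
  impossible _            ‵fromℕ       _    σq≡m = v≢m (trans (cong toℕ σq≡m) (F.toℕ-fromℕ m))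
  impossible (‵inject₁ p) (‵inject₁ q) σp≡0 σq≡m with F.<-cmp p q
  ... | tri< p<q _ _  = avoids132 (inject₁-< p<q) (inject₁<fromℕ q) σp<v (subst (_ F.<_) (sym σq≡m) v<m)
    where
    σp<v : lookup σ (inject₁ p) F.< lookup σ (fromℕ m)
    σp<v = subst (F._< _) (sym σp≡0) 0<v
  ... | tri≈ _ refl _ = ℕ.n≮0 (subst (lookup σ (fromℕ m) F.<_) (trans (sym σq≡m) σp≡0) v<m)
  ... | tri> _ _ q<p  = avoids312 (inject₁-< q<p) (inject₁<fromℕ p) σp<v (subst (_ F.<_) (sym σq≡m) v<m)
    where
    σp<v : lookup σ (inject₁ p) F.< lookup σ (fromℕ m)
    σp<v = subst (F._< _) (sym σp≡0) 0<v

inW′-init : ∀ {m} (σ : Word (suc m)) → InW′ σ →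
  ∃ λ τ → InW′ τ × (σ ≡ appendMax τ ⊎ σ ≡ appendMin τ)
inW′-init {m} σ σ-inW′@(σ-perm , _) with inW′-last-extreme σ σ-inW′
... | inj₂ last≡m =
  τ , shifted-inW′⁻ (appendMax τ) τ 0 (appendMax-shifted τ) (subst InW′ σ≡ σ-inW′) , inj₁ σ≡
  where
  σi≢top : ∀ i → m ≢ toℕ (lookup σ (inject₁ i))
  σi≢top i m≡σi = F.fromℕ≢inject₁ (σ-perm _ _ (F.toℕ-injective (trans last≡m m≡σi)))
  τ : Word m
  τ = tabulate λ i → F.lower₁ (lookup σ (inject₁ i)) (σi≢top i)
  σ≡ : σ ≡ appendMax τ
  σ≡ = ∷ʳ-ext σ (V.map inject₁ τ) (fromℕ m) (λ i → begin
    lookup σ (inject₁ i)                                   ≡⟨ F.inject₁-lower₁ _ (σi≢top i) ⟨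
    inject₁ (F.lower₁ (lookup σ (inject₁ i)) (σi≢top i))   ≡⟨ cong inject₁ (V.lookup∘tabulate _ i) ⟨
    inject₁ (lookup τ i)                                   ≡⟨ V.lookup-map i inject₁ τ ⟨
    lookup (V.map inject₁ τ) i                             ∎)
    (F.toℕ-injective (trans last≡m (sym (F.toℕ-fromℕ m))))
    where open ≡-Reasoning
... | inj₁ last≡0 =
  τ , shifted-inW′⁻ (appendMin τ) τ 1 (appendMin-shifted τ) (subst InW′ σ≡ σ-inW′) , inj₂ σ≡
  where
  σi≢0 : ∀ i → F.zero ≢ lookup σ (inject₁ i)
  σi≢0 i 0≡σi = F.fromℕ≢inject₁ (σ-perm _ _ (F.toℕ-injective (trans last≡0 (cong toℕ 0≡σi))))
  τ : Word m
  τ = tabulate λ i → F.punchOut (σi≢0 i)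
  σ≡ : σ ≡ appendMin τ
  σ≡ = ∷ʳ-ext σ (V.map F.suc τ) F.zero (λ i → begin
    lookup σ (inject₁ i)              ≡⟨ F.punchIn-punchOut (σi≢0 i) ⟨
    F.suc (F.punchOut (σi≢0 i))       ≡⟨ cong F.suc (V.lookup∘tabulate _ i) ⟨
    F.suc (lookup τ i)                ≡⟨ V.lookup-map i F.suc τ ⟨
    lookup (V.map F.suc τ) i          ∎)
    (F.toℕ-injective last≡0)
    where open ≡-Reasoning

-- Counting the standard monomials

-- Box K σ e says x^e ∉ 𝔪^{a ∖ expOf σ} for a = (K, …, K); Standard c m is the set of
-- standard monomials for a = (m + c, …, m + c), i.e. for the paper's c + 1 (standard≐∉dual).
Box : ∀ {m} → ℕ → Word m → Exp m → Set
Box K σ e = ∀ k → lookup e k + toℕ (lookup σ k) < K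

Standard : ℕ → ∀ m → Exp m → Set
Standard c m e = ∃ λ σ → InW′ σ × Box (m + c) σ e

module _ {m} (K : ℕ) (σ : Word (suc m)) (τ : Word m) (δ : ℕ) (shift : Shifted σ τ δ) (xs : Exp m) (x : ℕ) where

  box-shifted⁻ : Box K σ (xs ∷ʳ x) →
    (∀ i → lookup xs i + (δ + toℕ (lookup τ i)) < K) × x + toℕ (lookup σ (fromℕ m)) < K
  box-shifted⁻ box =
    (λ i → subst₂ (λ a b → a + b < K) (lookup-∷ʳ-inject₁ xs x i) (shift i) (box (inject₁ i))) ,
    subst (λ a → a + toℕ (lookup σ (fromℕ m)) < K) (lookup-∷ʳ-last xs x) (box (fromℕ m))

  box-shifted⁺ : (∀ i → lookup xs i + (δ + toℕ (lookup τ i)) < K) → x + toℕ (lookup σ (fromℕ m)) < K →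
    Box K σ (xs ∷ʳ x)
  box-shifted⁺ init< last< k with view k
  ... | ‵fromℕ     = subst (λ a → a + toℕ (lookup σ (fromℕ m)) < K) (sym (lookup-∷ʳ-last xs x)) last<
  ... | ‵inject₁ i = subst₂ (λ a b → a + b < K) (sym (lookup-∷ʳ-inject₁ xs x i)) (sym (shift i)) (init< i)

module _ {m} (τ : Word m) (xs : Exp m) (x : ℕ) where

  private
    max-shifted : Shifted (appendMax τ) τ 0
    max-shifted = appendMax-shifted τ
    min-shifted : Shifted (appendMin τ) τ 1
    min-shifted = appendMin-shifted τ
    x+0≡x : x + 0 ≡ x
    x+0≡x = ℕ.+-identityʳ x

  box-appendMax⁻ : ∀ {K} → Box K (appendMax τ) (xs ∷ʳ x) → Box K τ xs × x + m < K
  box-appendMax⁻ {K} box with init< , last< ← box-shifted⁻ K (appendMax τ) τ 0 max-shifted xs x box =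
    init< , subst (λ a → x + a < K) (appendMax-last τ) last<

  box-appendMax⁺ : ∀ {K} → Box K τ xs → x + m < K → Box K (appendMax τ) (xs ∷ʳ x)
  box-appendMax⁺ {K} box last< = box-shifted⁺ K (appendMax τ) τ 0 max-shifted xs x box
    (subst (λ a → x + a < K) (sym (appendMax-last τ)) last<)

  box-appendMin⁻ : ∀ {K} → Box (suc K) (appendMin τ) (xs ∷ʳ x) → Box K τ xs × x < suc K
  box-appendMin⁻ {K} box with init< , last< ← box-shifted⁻ (suc K) (appendMin τ) τ 1 min-shifted xs x box =
    (λ i → ℕ.s<s⁻¹ (subst (_< suc K) (ℕ.+-suc (lookup xs i) _) (init< i))) ,
    subst (_< suc K) (trans (cong (x +_) (appendMin-last τ)) x+0≡x) last<

  box-appendMin⁺ : ∀ {K} → Box K τ xs → x < suc K → Box (suc K) (appendMin τ) (xs ∷ʳ x)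
  box-appendMin⁺ {K} box x< = box-shifted⁺ (suc K) (appendMin τ) τ 1 min-shifted xs x
    (λ i → subst (_< suc K) (sym (ℕ.+-suc (lookup xs i) _)) (s≤s (box i)))
    (subst (_< suc K) (sym (trans (cong (x +_) (appendMin-last τ)) x+0≡x)) x<)

standard-mono : ∀ {c m xs} → Standard c m xs → Standard (suc c) m xs
standard-mono {c} {m} (σ , σ-inW′ , box) = σ , σ-inW′ , λ k → ℕ.<-≤-trans (box k) (ℕ.+-monoʳ-≤ m (ℕ.n≤1+n c))

module _ {c m : ℕ} (xs : Exp m) (x : ℕ) where

  private
    x+m<⇒x< : x + m < suc (m + c) → x < suc c
    x+m<⇒x< x+m< = ℕ.+-cancelʳ-< m x (suc c) (subst (x + m <_) (cong suc (ℕ.+-comm m c)) x+m<)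

    x<⇒x+m< : x < suc c → x + m < suc (m + c)
    x<⇒x+m< x< = subst (x + m <_) (cong suc (ℕ.+-comm c m)) (ℕ.+-monoˡ-< m x<)

  -- Delete the last entry of σ, which is its maximum or its minimum.
  standard-∷ʳ⁻ : Standard c (suc m) (xs ∷ʳ x) →
    (Standard (suc c) m xs × x < suc c) ⊎ (Standard c m xs × x < suc (m + c))
  standard-∷ʳ⁻ (σ , σ-inW′ , box) with inW′-init σ σ-inW′
  ... | τ , τ-inW′ , inj₁ refl with τ-box , x+m< ← box-appendMax⁻ τ xs x box =
    inj₁ ((τ , τ-inW′ , subst (λ K → Box K τ xs) (sym (ℕ.+-suc m c)) τ-box) , x+m<⇒x< x+m<)
  ... | τ , τ-inW′ , inj₂ refl with τ-box , x< ← box-appendMin⁻ τ xs x box =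
    inj₂ ((τ , τ-inW′ , τ-box) , x<)

  standard-∷ʳ⁺ : (Standard (suc c) m xs × x < suc c) ⊎ (Standard c m xs × x < suc (m + c)) →
    Standard c (suc m) (xs ∷ʳ x)
  standard-∷ʳ⁺ (inj₁ ((τ , τ-inW′ , τ-box) , x<)) =
    appendMax τ , inW′-appendMax {τ = τ} τ-inW′ ,
    box-appendMax⁺ τ xs x (subst (λ K → Box K τ xs) (ℕ.+-suc m c) τ-box) (x<⇒x+m< x<)
  standard-∷ʳ⁺ (inj₂ ((τ , τ-inW′ , τ-box) , x<)) =
    appendMin τ , inW′-appendMin {τ = τ} τ-inW′ , box-appendMin⁺ τ xs x τ-box x<

-- Split on the last exponent x: for x ≤ c both kinds of σ fit (and those ending in m cover those
-- ending in 0, by standard-mono); for larger x only those ending in 0 do.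
standard-card : ∀ m c → HasCard′ (Standard c m) (aPoly′ m (suc c))
standard-card zero c =
  L.[ [] ] , All.[] AllPairs.∷ AllPairs.[] ,
  (λ { [] → (λ _ → [] , ((λ ()) , (λ { {()} }) , (λ { {()} })) , λ ()) , λ _ → here refl }) , refl
standard-card (suc m) c = subst (HasCard′ (Standard c (suc m))) (sym (aPoly′-suc m (suc c)))
  (card-cong (to , from) (card-∪ small large disjoint))
  where
  Small Large : Exp (suc m) → Set
  Small e = ∃₂ λ xs x → Standard (suc c) m xs × x < suc c × xs ∷ʳ x ≡ e
  Large e = ∃₂ λ xs x → Standard c m xs × (suc c ≤ x × x < m + suc c) × xs ∷ʳ x ≡ e

  small : HasCard′ Small (aPoly′ m (suc (suc c)) * suc c)
  small = card-pairing _∷ʳ_ (V.∷ʳ-injective _ _) (standard-card m (suc c)) (card-< (suc c))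

  large : HasCard′ Large (aPoly′ m (suc c) * m)
  large = card-pairing _∷ʳ_ (V.∷ʳ-injective _ _) (standard-card m c) (card-interval (suc c) m)

  disjoint : ∀ {e} → Small e → ¬ Large e
  disjoint (xs , x , _ , x< , refl) (xs′ , x′ , _ , (≤x′ , _) , e≡) =
    ℕ.<⇒≱ x< (subst (suc c ≤_) (V.∷ʳ-injectiveʳ xs′ xs e≡) ≤x′)

  to : ∀ {e} → Small e ⊎ Large e → Standard c (suc m) e
  to (inj₁ (xs , x , std , x< , refl))       = standard-∷ʳ⁺ xs x (inj₁ (std , x<))
  to (inj₂ (xs , x , std , (_ , x<) , refl)) = standard-∷ʳ⁺ xs x (inj₂ (std , subst (x <_) (ℕ.+-suc m c) x<))

  from : ∀ {e} → Standard c (suc m) e → Small e ⊎ Large e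
  from {e} std with xs , x , refl ← V.initLast e with standard-∷ʳ⁻ xs x std
  ... | inj₁ (std′ , x<) = inj₁ (xs , x , std′ , x< , refl)
  ... | inj₂ (std′ , x<) with x ℕ.<? suc c
  ...   | yes x<₁ = inj₁ (xs , x , standard-mono {xs = xs} std′ , x<₁ , refl)
  ...   | no  x≮  = inj₂ (xs , x , std′ , (ℕ.≮⇒≥ x≮ , subst (x <_) (sym (ℕ.+-suc m c)) x<) , refl)

-- The Alexander dual

lookup-diffₐ : ∀ {n k} (a : Exp n) (σ : Vec (Fin k) n) i →
  lookup (diffₐ a (V.map (λ j → suc (toℕ j)) σ)) i ≡ lookup a i ∸ toℕ (lookup σ i)
lookup-diffₐ (a ∷ as) (s ∷ σ) F.zero    = refl
lookup-diffₐ (a ∷ as) (s ∷ σ) (F.suc i) = lookup-diffₐ as σ i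

sum-tabulate-perm : ∀ {n} (σ : Word n) → IsPerm σ → sum (L.tabulate (toℕ ∘ lookup σ)) ≡ sum (L.tabulate {n = n} toℕ)
sum-tabulate-perm {n} σ σ-perm = begin
  sum (L.tabulate (toℕ ∘ lookup σ))        ≡⟨ cong sum (L.map-tabulate {n = n} (lookup σ) toℕ) ⟨
  sum (L.map toℕ (L.tabulate (lookup σ)))  ≡⟨ sum-↭ (↭.map⁺ toℕ σ↭id) ⟩
  sum (L.map toℕ (allFin n))               ≡⟨ cong sum (L.map-tabulate {n = n} id toℕ) ⟩
  sum (L.tabulate {n = n} toℕ)             ∎
  where
  open ≡-Reasoning
  σ↭id : L.tabulate (lookup σ) ↭ allFin n
  σ↭id = ∼bag⇒↭ (unique∧set⇒bag (Unique.tabulate⁺ (σ-perm _ _)) (Unique.allFin⁺ n) (mk⇔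
    (λ _ → ∈.∈-allFin _)
    (λ _ → let p , σp≡v = perm-surjective σ σ-perm _ in subst (_∈ L.tabulate (lookup σ)) σp≡v (∈.∈-tabulate⁺ p))))

≤-sum-≡⇒≡ : ∀ {n} (f g : Fin n → ℕ) → (∀ i → f i ≤ g i) → sum (L.tabulate f) ≡ sum (L.tabulate g) → ∀ i → f i ≡ g i
≤-sum-≡⇒≡ f g f≤g sum≡ F.zero with ℕ.m≤n⇒m<n∨m≡n (f≤g F.zero)
... | inj₂ f₀≡g₀ = f₀≡g₀
... | inj₁ f₀<g₀ = contradiction sum≡ (ℕ.<⇒≢ (ℕ.+-mono-<-≤ f₀<g₀ (sum-≤ (f ∘ F.suc) (g ∘ F.suc) (f≤g ∘ F.suc))))
  where
  sum-≤ : ∀ {k} (f g : Fin k → ℕ) → (∀ i → f i ≤ g i) → sum (L.tabulate f) ≤ sum (L.tabulate g)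
  sum-≤ {zero}  f g f≤g = z≤n
  sum-≤ {suc k} f g f≤g = ℕ.+-mono-≤ (f≤g F.zero) (sum-≤ (f ∘ F.suc) (g ∘ F.suc) (f≤g ∘ F.suc))
≤-sum-≡⇒≡ f g f≤g sum≡ (F.suc i) =
  ≤-sum-≡⇒≡ (f ∘ F.suc) (g ∘ F.suc) (f≤g ∘ F.suc)
    (ℕ.+-cancelˡ-≡ (f F.zero) _ _ (trans sum≡ (cong (_+ _) (sym (≤-sum-≡⇒≡ f g f≤g sum≡ F.zero))))) i

lookup-expOf : ∀ {n} (σ : Word n) i → lookup (expOf σ) i ≡ suc (toℕ (lookup σ i))
lookup-expOf σ i = V.lookup-map i _ σ

-- Minimality: exponent vectors of permutations all have the same sum.
expOf-minGen : ∀ {n} (σ : Word n) → InW σ → MinGen (GenIW n) (expOf σ)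
expOf-minGen {n} σ σ-inW@(σ-perm , _) = (σ , σ-inW , refl) , minimal
  where
  minimal : ∀ g → GenIW n g → g ∣ₘ expOf σ → g ≡ expOf σ
  minimal _ (σ′ , (σ′-perm , _) , refl) σ′∣σ = lookup-ext λ i → begin
    lookup (expOf σ′) i       ≡⟨ lookup-expOf σ′ i ⟩
    suc (toℕ (lookup σ′ i))   ≡⟨ cong suc (≤-sum-≡⇒≡ (toℕ ∘ lookup σ′) (toℕ ∘ lookup σ) σ′≤σ sum≡ i) ⟩
    suc (toℕ (lookup σ i))    ≡⟨ lookup-expOf σ i ⟨
    lookup (expOf σ) i        ∎
    where
    open ≡-Reasoning
    σ′≤σ : ∀ i → toℕ (lookup σ′ i) ≤ toℕ (lookup σ i)
    σ′≤σ i = ℕ.s≤s⁻¹ (subst₂ _≤_ (lookup-expOf σ′ i) (lookup-expOf σ i) (σ′∣σ i))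
    sum≡ : sum (L.tabulate (toℕ ∘ lookup σ′)) ≡ sum (L.tabulate (toℕ ∘ lookup σ))
    sum≡ = trans (sum-tabulate-perm σ′ σ′-perm) (sym (sum-tabulate-perm σ σ-perm))

module _ {n} (K : ℕ) (n≤K : n ≤ K) (σ : Word n) (e : Exp n) where

  private
    a : Exp n
    a = replicate n K

    diff≡ : ∀ i → lookup (diffₐ a (expOf σ)) i ≡ K ∸ toℕ (lookup σ i)
    diff≡ i = trans (lookup-diffₐ a σ i) (cong (_∸ toℕ (lookup σ i)) (V.lookup-replicate i K))

    σi<K : ∀ i → toℕ (lookup σ i) < K
    σi<K i = ℕ.<-≤-trans (F.toℕ<n (lookup σ i)) n≤K

  inMPow⇒¬box : InMPow (diffₐ a (expOf σ)) e → ¬ Box K σ e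
  inMPow⇒¬box (i , _ , dᵢ≤eᵢ) box = ℕ.<⇒≱ (box i) (begin
    K                                         ≡⟨ ℕ.m∸n+n≡m (ℕ.<⇒≤ (σi<K i)) ⟨
    K ∸ toℕ (lookup σ i) + toℕ (lookup σ i)   ≤⟨ ℕ.+-monoˡ-≤ (toℕ (lookup σ i)) (subst (_≤ lookup e i) (diff≡ i) dᵢ≤eᵢ) ⟩
    lookup e i + toℕ (lookup σ i)             ∎)
    where open ℕ.≤-Reasoning

  ¬box⇒inMPow : ¬ Box K σ e → InMPow (diffₐ a (expOf σ)) e
  ¬box⇒inMPow ¬box with i , ¬eᵢ+σᵢ<K ← F.¬∀⟶∃¬ n _ (λ i → lookup e i + toℕ (lookup σ i) ℕ.<? K) ¬box =
    i , subst (1 ≤_) (sym (diff≡ i)) (ℕ.m<n⇒0<n∸m (σi<K i)) ,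
    subst (_≤ lookup e i) (sym (diff≡ i))
      (subst (K ∸ toℕ (lookup σ i) ≤_) (ℕ.m+n∸n≡m (lookup e i) (toℕ (lookup σ i)))
        (ℕ.∸-monoˡ-≤ (toℕ (lookup σ i)) (ℕ.≮⇒≥ ¬eᵢ+σᵢ<K)))

module _ (n c : ℕ) where

  private
    Dual : Exp n → Set
    Dual = InAlexDual (GenIW n) (replicate n (n + c))
    n≤K : n ≤ n + c
    n≤K = ℕ.m≤m+n n c

  standard⇒∉dual : ∀ {e} → Standard c n e → ¬ Dual e
  standard⇒∉dual {e} (σ , σ-inW′ , box) dual =
    inMPow⇒¬box (n + c) n≤K σ e (dual (expOf σ) (expOf-minGen σ (inW′⇒inW σ σ-inW′))) box

  -- Standard c n is decidable, being finite, so we may argue by contradiction.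
  ∉dual⇒standard : ∀ {e} → ¬ Dual e → Standard c n e
  ∉dual⇒standard {e} ∉dual with card-decidable (V.≡-dec ℕ._≟_) (standard-card n c) e
  ... | yes std = std
  ... | no ¬std = ⊥-elim (∉dual λ { _ ((σ , σ-inW , refl) , _) →
    ¬box⇒inMPow (n + c) n≤K σ e (λ box → ¬std (σ , inW⇒inW′ σ σ-inW , box)) })

  standard≐∉dual : Standard c n ≐ (¬_ ∘ Dual)
  standard≐∉dual = (λ {e} → standard⇒∉dual {e}) , (λ {e} → ∉dual⇒standard {e})

proposition4 : ∀ (n c : ℕ) → 1 ≤ n → 1 ≤ c →
    DimQuotientIs (InAlexDual (GenIW n) (replicate n (n + c ∸ 1))) (aPoly n c)
proposition4 (suc n) (suc c) _ _ rewrite ℕ.+-suc n c =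
  subst (DimQuotientIs (InAlexDual (GenIW (suc n)) (replicate (suc n) (suc n + c)))) (sym (aPoly≡aPoly′ n (suc c)))
    (card-cong (standard≐∉dual (suc n) c) (standard-card (suc n) c))
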